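{- Let $G$ be a banana tree with at least two vertices, let $v$ be a leaf of $G$ with unique neighbor $w$, let $a=|E(v,w)|$, and let $G'=G-v$ be the banana tree obtained by deleting $v$ and its incident edges. Then \[f(G,v,0)=\min\{1+f(G',w,0),\ a+f(G',w,a)\},\] and for every integer $k>0$, \[f(G,v,k)=\min\left\{f\!\left(G',w,a\lfloor k/a\rfloor\right),\ a\lceil k/a\rceil-k+f\!\left(G',w,a\lceil k/a\rceil\right)\right\}.\]
   Context: Graphs are finite, connected, loopless multigraphs. A banana tree is a multigraph whose underlying simple graph (one edge kept between each adjacent pair) is a tree; a leaf is a vertex with exactly one neighbor. For vertices $v,w$, $|E(v,w)|$ is the number of edges joining them and $\mathrm{val}(v)$ the number of edges at $v$. A divisor is $D:V\to\mathbb{Z}$, degree $\sum_v D(v)$, effective if nonnegative. Firing $v$ changes $D$ to $D'$ with $D'(v)=D(v)-\mathrm{val}(v)$, $D'(w)=D(w)+|E(v,w)|$ for $w\ne v$; $D\sim D'$ if related by finitely many firings. The rank $r(D)$ is $-1$ if $D$ is equivalent to no effective divisor, else the largest $r\ge 0$ such that $D-E$ is equivalent to an effective divisor for every effective $E$ of degree $r$. For a banana tree $G$, a vertex $v$ and an integer $k\ge0$, $f(G,v,k)$ denotes the minimum degree of an effective divisor $D$ on $G$ such that $r(D+k\cdot v)>0$ (here $k\cdot v$ is the divisor with $k$ chips on $v$ and $0$ elsewhere). In particular $f(G,v,0)$ is the gonality of $G$ (minimum degree of a divisor of rank at least $1$). -}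

module Defs where

open import Data.Nat as ℕ using (ℕ; zero; suc; _<_)
open import Data.Integer as ℤ using (ℤ; +_)
open import Data.Fin using (Fin; zero; suc; punchIn; _≟_)
open import Data.Vec as Vec using (Vec; lookup)
open import Data.Product using (Σ; ∃; _×_; _,_)
open import Relation.Nullary using (¬_; yes; no)
open import Relation.Binary.PropositionalEquality using (_≡_; _≢_)
open import Relation.Binary.Construct.Closure.ReflexiveTransitive using (Star)

sumFinℕ : ∀ {n} → (Fin n → ℕ) → ℕ
sumFinℕ {zero}  f = 0
sumFinℕ {suc n} f = f zero ℕ.+ sumFinℕ (λ i → f (suc i))

sumFinℤ : ∀ {n} → (Fin n → ℤ) → ℤ
sumFinℤ {zero}  f = + 0
sumFinℤ {suc n} f = f zero ℤ.+ sumFinℤ (λ i → f (suc i))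

-- Loopless multigraphs on vertex set Fin n.
-- E u w = |E(u,w)| is the number of edges joining u and w.

record MGraph (n : ℕ) : Set where
  field
    E        : Fin n → Fin n → ℕ
    symmetric : ∀ u w → E u w ≡ E w u
    loopless  : ∀ u → E u u ≡ 0
open MGraph public

module _ {n : ℕ} (G : MGraph n) where

  val : Fin n → ℕ
  val v = sumFinℕ (λ u → E G v u)

  Adj : Fin n → Fin n → Set
  Adj u w = 0 < E G u w

  Connected : Set
  Connected = ∀ u w → Star Adj u w

  -- a cycle in the underlying simple graph: k ≥ 3 pairwise distinct
  -- vertices x₀,…,x_{k-1} with x_i adjacent to x_{i+1} (indices mod k)
  HasCycle : Set
  HasCycle = Σ ℕ λ k → Σ (Vec (Fin n) (suc (suc (suc k)))) λ xs →
      (∀ i j → lookup xs i ≡ lookup xs j → i ≡ j)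
    × (∀ (i : Fin (suc (suc k))) → Adj (lookup xs (Data.Fin.inject₁ i)) (lookup xs (suc i)))
    × Adj (lookup xs (Data.Fin.fromℕ (suc (suc k)))) (lookup xs zero)

  -- banana tree: the underlying simple graph is a tree (connected, acyclic)
  BananaTree : Set
  BananaTree = Connected × ¬ HasCycle

  LeafWithNeighbour : Fin n → Fin n → Set
  LeafWithNeighbour v w = Adj v w × (∀ u → Adj v u → u ≡ w)

  Divisor : Set
  Divisor = Fin n → ℤ

  deg : Divisor → ℤ
  deg D = sumFinℤ D

  Effective : Divisor → Set
  Effective D = ∀ u → + 0 ℤ.≤ D u

  fire : Fin n → Divisor → Divisor
  fire v D u with u ≟ v
  ... | yes _ = D u ℤ.- + val v
  ... | no  _ = D u ℤ.+ + E G v u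

  FireStep : Divisor → Divisor → Set
  FireStep D D′ = ∃ λ v → D′ ≡ fire v D

  _∼_ : Divisor → Divisor → Set
  D ∼ D′ = Star FireStep D D′

  EquivEffective : Divisor → Set
  EquivEffective D = ∃ λ D′ → D ∼ D′ × Effective D′

  _-ᴰ_ : Divisor → Divisor → Divisor
  (D -ᴰ F) u = D u ℤ.- F u

  _+ᴰ_ : Divisor → Divisor → Divisor
  (D +ᴰ F) u = D u ℤ.+ F u

  chips : ℕ → Fin n → Divisor
  chips k v u with u ≟ v
  ... | yes _ = + k
  ... | no  _ = + 0

  -- r(D) ≥ r  (for r ≥ 0): D-E is equivalent to an effective divisor for
  -- every effective E of degree r (r = 0 gives "D equivalent to effective").
  RankAtLeast : Divisor → ℕ → Set
  RankAtLeast D r = EquivEffective D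
    × (∀ F → Effective F → deg F ≡ + r → EquivEffective (D -ᴰ F))

  PositiveRank : Divisor → Set
  PositiveRank D = RankAtLeast D 1

  -- IsF v k m : m = f(G,v,k), the minimum degree of an effective divisor D
  -- with r(D + k·v) > 0.
  IsF : Fin n → ℕ → ℕ → Set
  IsF v k m =
      (∃ λ D → Effective D × deg D ≡ + m × PositiveRank (D +ᴰ chips k v))
    × (∀ D → Effective D → PositiveRank (D +ᴰ chips k v) → + m ℤ.≤ deg D)

-- G - v : delete vertex v (vertices of G - v are Fin n, embedded by punchIn v)

delete : ∀ {n} → MGraph (suc n) → Fin (suc n) → MGraph n
delete G v = record
  { E = λ i j → E G (punchIn v i) (punchIn v j)
  ; symmetric = λ i j → symmetric G (punchIn v i) (punchIn v j)
  ; loopless = λ i → loopless G (punchIn v i)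
  }

-- floor and ceiling of k / a (a ≥ 1; value for a = 0 is irrelevant, set to 0)

⌊_/_⌋ : ℕ → ℕ → ℕ
⌊ k / zero ⌋  = 0
⌊ k / suc a ⌋ = k ℕ./ suc a

⌈_/_⌉ : ℕ → ℕ → ℕ
⌈ k / zero ⌉  = 0
⌈ k / suc a ⌉ = (k ℕ.+ a) ℕ./ suc a

{-# OPTIONS --safe #-}
-- Firing every vertex x exactly z x times turns D into D - Δz (Δ the Laplacian), so D is
-- equivalent to an effective divisor iff D - Δz ≥ 0 for some integer script z, and r(D) > 0 iff
-- D - u is winnable in this sense for every vertex u.  At the leaf v a script is a script on
-- G′ = G - v together with t = z v - z w, which moves a·t chips from v to w; hence D is winnable
-- iff D|G′ + a·t·w is winnable on G′ for some t with a·t ≤ D v, and t = ⌊D v / a⌋ is the best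
-- choice.  So with d = D v and Y = D|G′, r(D + k·v) > 0 comes down to Y + a⌊(d + k)/a⌋·w having
-- positive rank on G′ (and Y - a·w being winnable when d + k = 0).  Minimising d + deg Y, either
-- the quotient ⌊(d + k)/a⌋ stays at its least possible value, or it reaches the next multiple,
-- ⌈k/a⌉ (resp. 1 when k = 0), and then the extra chips at v cost a⌈k/a⌉ - k (resp. a).  The
-- minima f(G′, w, j) exist because winnability on banana trees is decidable by peeling leaves.
module Submission where

open import Defs
open import Data.Integer.Base using (ℤ; +_; -[1+_]; 0ℤ; ∣_∣)
import Data.Integer as Int
import Data.Integer.Properties as ℤP
open import Data.Integer.DivMod using ([n/ℕd]*d≤n; n<s[n/ℕd]*d)
open import Data.Integer.Tactic.RingSolver using (solve-∀)
open import Algebra.Properties.Semiring.Sum ℤP.+-*-semiring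
  using (sum; sum-cong-≗; sum-remove; sum-replicate-zero; ∑-distrib-+; ∑-comm)
open import Data.Nat.Base as ℕ using (ℕ; zero; suc; z≤n; s≤s)
import Data.Nat.Properties as ℕP
open import Data.Fin.Base using (Fin; zero; suc; punchIn; punchOut; toℕ; inject₁; fromℕ)
open import Data.Fin.Properties
  using ( _≟_; any?; all?; punchInᵢ≢i; punchIn-injective; punchOut-cong; punchOut-punchIn
        ; punchIn-punchOut; pigeonhole; toℕ-injective; toℕ<n; toℕ-inject₁; toℕ-fromℕ)
open import Data.Vec.Base using (Vec; lookup; tabulate; map)
open import Data.Vec.Functional using (_∷_)
open import Data.Vec.Properties using (lookup∘tabulate; lookup-map)
open import Data.Product using (∃; ∃₂; _×_; _,_; proj₁; proj₂)
open import Data.Sum using (_⊎_; inj₁; inj₂; [_,_]′)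
open import Data.Empty using (⊥-elim)
open import Function.Base using (_∘_; const)
open import Relation.Nullary using (¬_; Dec; yes; no)
open import Relation.Nullary.Decidable using (_×-dec_; _→-dec_; ¬?; decidable-stable; map′)
open import Relation.Binary.Definitions using (tri<; tri≈; tri>)
open import Relation.Unary using (Decidable)
open import Relation.Binary.PropositionalEquality
open import Relation.Binary.Construct.Closure.ReflexiveTransitive using (Star; ε; _◅_; _◅◅_)

module _ where
  open Int using (_+_; _-_; _*_; -_; _≤_)

  sumFinℤ≡sum : ∀ {n} (f : Fin n → ℤ) → sumFinℤ f ≡ sum f
  sumFinℤ≡sum {zero}  f = refl
  sumFinℤ≡sum {suc n} f = cong (_+_ (f zero)) (sumFinℤ≡sum (f ∘ suc))

  +-sumFinℕ : ∀ {n} (f : Fin n → ℕ) → + sumFinℕ f ≡ sum (λ i → + f i)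
  +-sumFinℕ {zero}  f = refl
  +-sumFinℕ {suc n} f = trans (ℤP.pos-+ (f zero) _) (cong (_+_ (+ f zero)) (+-sumFinℕ (f ∘ suc)))

  sum-cong : ∀ {n} {f g : Fin n → ℤ} → f ≗ g → sum f ≡ sum g
  sum-cong = sum-cong-≗

  sumFinℤ-cong : ∀ {n} {f g : Fin n → ℤ} → f ≗ g → sumFinℤ f ≡ sumFinℤ g
  sumFinℤ-cong {f = f} {g} f≗g = trans (sumFinℤ≡sum f) (trans (sum-cong f≗g) (sym (sumFinℤ≡sum g)))

  sum-neg : ∀ {n} (f : Fin n → ℤ) → sum (λ i → - f i) ≡ - sum f
  sum-neg {zero}  f = refl
  sum-neg {suc n} f =
    trans (cong (_+_ (- f zero)) (sum-neg (f ∘ suc))) (sym (ℤP.neg-distrib-+ (f zero) _))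

  sum-nonneg : ∀ {n} (f : Fin n → ℤ) → (∀ i → 0ℤ ≤ f i) → 0ℤ ≤ sum f
  sum-nonneg {zero}  f f≥0 = ℤP.≤-refl
  sum-nonneg {suc n} f f≥0 = ℤP.+-mono-≤ (f≥0 zero) (sum-nonneg (f ∘ suc) (f≥0 ∘ suc))

  sum-sub : ∀ {n} (f g : Fin n → ℤ) → sum (λ i → f i - g i) ≡ sum f - sum g
  sum-sub f g = trans (∑-distrib-+ f (λ i → - g i)) (cong (_+_ (sum f)) (sum-neg g))

  sum-single : ∀ {n} (v : Fin n) (f : Fin n → ℤ) → (∀ u → u ≢ v → f u ≡ 0ℤ) → sum f ≡ f v
  sum-single {suc n} v f f≡0 = begin
    sum f                      ≡⟨ sum-remove {i = v} f ⟩
    f v + sum (f ∘ punchIn v)  ≡⟨ cong (_+_ (f v)) (sum-cong (λ i → f≡0 _ (punchInᵢ≢i v i))) ⟩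
    f v + sum {n} (const 0ℤ)   ≡⟨ cong (_+_ (f v)) (sum-replicate-zero n) ⟩
    f v + 0ℤ                   ≡⟨ ℤP.+-identityʳ (f v) ⟩
    f v                        ∎
    where open ≡-Reasoning

  δ : ∀ {n} → Fin n → Fin n → ℤ
  δ v u with u ≟ v
  ... | yes _ = + 1
  ... | no  _ = 0ℤ

  δ-self : ∀ {n} (v : Fin n) → δ v v ≡ + 1
  δ-self v with v ≟ v
  ... | yes _   = refl
  ... | no  v≢v = ⊥-elim (v≢v refl)

  δ-other : ∀ {n} {v u : Fin n} → u ≢ v → δ v u ≡ 0ℤ
  δ-other {v = v} {u} u≢v with u ≟ v
  ... | yes u≡v = ⊥-elim (u≢v u≡v)
  ... | no  _   = refl

  δ-nonneg : ∀ {n} (v u : Fin n) → 0ℤ ≤ δ v u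
  δ-nonneg v u with u ≟ v
  ... | yes _ = Int.+≤+ z≤n
  ... | no  _ = Int.+≤+ z≤n

  sum-δ : ∀ {n} (v : Fin n) → sum (δ v) ≡ + 1
  sum-δ v = trans (sum-single v (δ v) (λ _ → δ-other)) (δ-self v)

  chips≗δ : ∀ {n} (H : MGraph n) k v u → chips H k v u ≡ δ v u * + k
  chips≗δ H k v u with u ≟ v
  ... | yes _ = sym (ℤP.*-identityˡ (+ k))
  ... | no  _ = refl

  addChips : ∀ {n} → Fin n → ℤ → (Fin n → ℤ) → Fin n → ℤ
  addChips w c D u = D u + δ w u * c

  addChips-cong : ∀ {n} (w : Fin n) c {D D′} → D ≗ D′ → addChips w c D ≗ addChips w c D′
  addChips-cong w c D≗D′ u = cong (_+ δ w u * c) (D≗D′ u)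

  sum-addChips : ∀ {n} (w : Fin n) c D → sum (addChips w c D) ≡ sum D + c
  sum-addChips w c D = begin
    sum (addChips w c D)                ≡⟨ ∑-distrib-+ D (λ u → δ w u * c) ⟩
    sum D + sum (λ u → δ w u * c)       ≡⟨ cong (_+_ (sum D)) (sum-single w _ off-w) ⟩
    sum D + δ w w * c                   ≡⟨ cong (λ t → sum D + t * c) (δ-self w) ⟩
    sum D + + 1 * c                     ≡⟨ cong (_+_ (sum D)) (ℤP.*-identityˡ c) ⟩
    sum D + c                           ∎
    where
    open ≡-Reasoning
    off-w : ∀ u → u ≢ w → δ w u * c ≡ 0ℤ
    off-w _ u≢w = cong (_* c) (δ-other u≢w)

  addChips-mono : ∀ {n} (w : Fin n) {c c′} → c ≤ c′ → ∀ D u → addChips w c D u ≤ addChips w c′ D u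
  addChips-mono w {c} {c′} c≤c′ D u with u ≟ w
  ... | yes _ = ℤP.+-monoʳ-≤ (D u) (subst₂ _≤_ (sym (ℤP.*-identityˡ c)) (sym (ℤP.*-identityˡ c′)) c≤c′)
  ... | no  _ = ℤP.≤-refl

  δ-suc : ∀ {n} (v u : Fin n) → δ (suc v) (suc u) ≡ δ v u
  δ-suc v u with u ≟ v
  ... | yes _ = refl
  ... | no  _ = refl

  sumFinℕ≡0 : ∀ {n} (y : Fin n → ℕ) → sumFinℕ y ≡ 0 → ∀ x → y x ≡ 0
  sumFinℕ≡0 y Σy≡0 zero    = ℕP.m+n≡0⇒m≡0 (y zero) Σy≡0
  sumFinℕ≡0 y Σy≡0 (suc x) = sumFinℕ≡0 (y ∘ suc) (ℕP.m+n≡0⇒n≡0 (y zero) Σy≡0) x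

  sumFinℕ-peel : ∀ {n N} (y : Fin n → ℕ) → sumFinℕ y ≡ suc N →
    ∃₂ λ v y′ → sumFinℕ y′ ≡ N × (∀ x → + y x ≡ δ v x + + y′ x)
  sumFinℕ-peel {suc n} y Σy≡1+N with y zero in y₀
  ... | suc k = zero , y′ , ℕP.suc-injective Σy≡1+N , split
    where
    y′ : Fin (suc n) → ℕ
    y′ zero    = k
    y′ (suc i) = y (suc i)
    split : ∀ x → + y x ≡ δ zero x + + y′ x
    split zero    = cong +_ y₀
    split (suc x) = sym (ℤP.+-identityˡ (+ y (suc x)))
  ... | zero with sumFinℕ-peel (y ∘ suc) Σy≡1+N
  ...   | v , y″ , Σy″≡N , split″ = suc v , y′ , Σy″≡N , split
    where
    y′ : Fin (suc n) → ℕ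
    y′ zero    = 0
    y′ (suc i) = y″ i
    split : ∀ x → + y x ≡ δ (suc v) x + + y′ x
    split zero    = cong +_ y₀
    split (suc x) = trans (split″ x) (cong (_+ + y″ x) (sym (δ-suc v x)))

  term≤sumFinℕ : ∀ {n} (y : Fin n → ℕ) x → y x ℕ.≤ sumFinℕ y
  term≤sumFinℕ y zero    = ℕP.m≤m+n (y zero) _
  term≤sumFinℕ y (suc x) = ℕP.≤-trans (term≤sumFinℕ (y ∘ suc) x) (ℕP.m≤n+m _ (y zero))

  0≤i+c : ∀ i {c} → ∣ i ∣ ℕ.≤ c → 0ℤ ≤ i + + c
  0≤i+c (+ k)    _   = Int.+≤+ z≤n
  0≤i+c -[1+ k ] k<c = subst (0ℤ ≤_) (sym (ℤP.⊖-≥ k<c)) (Int.+≤+ z≤n)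

  unit-mass : ∀ {n} (F : Fin n → ℤ) → (∀ i → 0ℤ ≤ F i) → sum F ≡ + 1 → ∃ λ u → F ≗ δ u
  unit-mass F F≥0 ΣF≡1 = conclude (sumFinℕ-peel (∣_∣ ∘ F) Σ∣F∣≡1)
    where
    open ≡-Reasoning
    F≡∣F∣ : ∀ i → F i ≡ + ∣ F i ∣
    F≡∣F∣ i = sym (ℤP.0≤i⇒+∣i∣≡i (F≥0 i))
    Σ∣F∣≡1 : sumFinℕ (∣_∣ ∘ F) ≡ 1
    Σ∣F∣≡1 = ℤP.+-injective (trans (+-sumFinℕ (∣_∣ ∘ F)) (trans (sym (sum-cong F≡∣F∣)) ΣF≡1))
    conclude : (∃₂ λ u g → sumFinℕ g ≡ 0 × (∀ i → + ∣ F i ∣ ≡ δ u i + + g i)) → ∃ λ u → F ≗ δ u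
    conclude (u , g , Σg≡0 , split) = u , λ i → begin
      F i                 ≡⟨ F≡∣F∣ i ⟩
      + ∣ F i ∣           ≡⟨ split i ⟩
      δ u i + + g i       ≡⟨ cong (λ k → δ u i + + k) (sumFinℕ≡0 g Σg≡0 i) ⟩
      δ u i + 0ℤ          ≡⟨ ℤP.+-identityʳ (δ u i) ⟩
      δ u i               ∎

  δ-removal-≤ : ∀ {n} (X : Fin n → ℤ) u i → X i - δ u i ≤ X i
  δ-removal-≤ X u i = subst (X i - δ u i ≤_) (ℤP.+-identityʳ (X i))
                             (ℤP.+-monoʳ-≤ (X i) (ℤP.neg-mono-≤ (δ-nonneg u i)))

module _ {P : ℕ → Set} (P? : Decidable P) where
  open import Data.Nat.Base using (_≤_; _<_)

  Least : ℕ → Set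
  Least m = P m × ∀ k → P k → m ≤ k

  least-or-none : ∀ N → ∃ Least ⊎ (∀ k → k ≤ N → ¬ P k)
  least-or-none zero with P? zero
  ... | yes P0 = inj₁ (0 , P0 , λ _ _ → z≤n)
  ... | no ¬P0 = inj₂ λ { .zero z≤n → ¬P0 }
  least-or-none (suc N) with least-or-none N
  ... | inj₁ found = inj₁ found
  ... | inj₂ none with P? (suc N)
  ...   | yes P1+N = inj₁ (suc N , P1+N , λ k Pk → ℕP.≮⇒≥ (λ k<1+N → none k (ℕ.s≤s⁻¹ k<1+N) Pk))
  ...   | no ¬P1+N = inj₂ λ k k≤1+N →
    [ (λ k<1+N → none k (ℕ.s≤s⁻¹ k<1+N)) , (λ { refl → ¬P1+N }) ]′ (ℕP.m≤n⇒m<n∨m≡n k≤1+N)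

  least : ∀ {N} → P N → ∃ Least
  least {N} PN with least-or-none N
  ... | inj₁ found = found
  ... | inj₂ none  = ⊥-elim (none N ℕP.≤-refl PN)

  any<? : ∀ n → Dec (∃ λ k → k < n × P k)
  any<? n with least-or-none n
  ... | inj₂ none = no λ (k , k<n , Pk) → none k (ℕP.<⇒≤ k<n) Pk
  ... | inj₁ (m , Pm , m-least) with m ℕP.<? n
  ...   | yes m<n = yes (m , m<n , Pm)
  ...   | no  m≮n = no λ (k , k<n , Pk) → m≮n (ℕP.≤-<-trans (m-least k Pk) k<n)

module _ where
  open import Data.Nat.Base using (_+_; _*_; _≤_; _<_; _/_)
  open import Data.Nat.DivMod using (m/n*n≤m; m*n/n≡m; /-monoˡ-≤; m/n≡1+[m∸n]/n; m≡m%n+[m/n]*n; m%n<n)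

  a*⌊k/a⌋≤k : ∀ a k → a * ⌊ k / a ⌋ ≤ k
  a*⌊k/a⌋≤k zero    k = z≤n
  a*⌊k/a⌋≤k (suc a) k = ℕP.≤-trans (ℕP.≤-reflexive (ℕP.*-comm (suc a) (k / suc a))) (m/n*n≤m k (suc a))

  a*q≤d⇒q≤⌊d/a⌋ : ∀ {a q d} → 0 < a → a * q ≤ d → q ≤ ⌊ d / a ⌋
  a*q≤d⇒q≤⌊d/a⌋ {suc a} {q} {d} _ aq≤d = ℕP.≤-trans (ℕP.≤-reflexive (sym (m*n/n≡m q (suc a))))
    (/-monoˡ-≤ (suc a) (ℕP.≤-trans (ℕP.≤-reflexive (ℕP.*-comm q (suc a))) aq≤d))

  a*⌊0/a⌋≡0 : ∀ a → a * ⌊ 0 / a ⌋ ≡ 0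
  a*⌊0/a⌋≡0 zero    = refl
  a*⌊0/a⌋≡0 (suc a) = ℕP.*-zeroʳ (suc a)

  ⌊/⌋-monoˡ-≤ : ∀ a {k d} → k ≤ d → ⌊ k / a ⌋ ≤ ⌊ d / a ⌋
  ⌊/⌋-monoˡ-≤ zero    _   = z≤n
  ⌊/⌋-monoˡ-≤ (suc a) k≤d = /-monoˡ-≤ (suc a) k≤d

  ⌈k/a⌉≤1+⌊k/a⌋ : ∀ a k → ⌈ k / a ⌉ ≤ suc ⌊ k / a ⌋
  ⌈k/a⌉≤1+⌊k/a⌋ zero    k = z≤n
  ⌈k/a⌉≤1+⌊k/a⌋ (suc a) k = begin
    (k + a) / suc a              ≤⟨ /-monoˡ-≤ (suc a) (ℕP.+-monoʳ-≤ k (ℕP.n≤1+n a)) ⟩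
    (k + suc a) / suc a          ≡⟨ m/n≡1+[m∸n]/n (ℕP.m≤n+m (suc a) k) ⟩
    suc ((k + suc a ℕ.∸ suc a) / suc a) ≡⟨ cong (λ t → suc (t / suc a)) (ℕP.m+n∸n≡m k (suc a)) ⟩
    suc (k / suc a)              ∎
    where open ℕP.≤-Reasoning

  k≤a*⌈k/a⌉ : ∀ {a} k → 0 < a → k ≤ a * ⌈ k / a ⌉
  k≤a*⌈k/a⌉ {suc a} k _ = ℕP.+-cancelˡ-≤ a k (suc a * ⌈ k / suc a ⌉) (begin
    a + k                                        ≡⟨ ℕP.+-comm a k ⟩
    k + a                                        ≡⟨ m≡m%n+[m/n]*n (k + a) (suc a) ⟩
    (k + a) ℕ.% suc a + (k + a) / suc a * suc a  ≤⟨ ℕP.+-monoˡ-≤ _ (ℕ.s≤s⁻¹ (m%n<n (k + a) (suc a))) ⟩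
    a + (k + a) / suc a * suc a                  ≡⟨ cong (_+_ a) (ℕP.*-comm ((k + a) / suc a) (suc a)) ⟩
    a + suc a * ((k + a) / suc a)                ∎)
    where open ℕP.≤-Reasoning

module _ {n} (H : MGraph n) where
  open Int using (_+_; _-_; _*_; -_; _≤_)

  -- D u - laplacian z u is what u holds after every vertex x has fired z x times.
  laplacian : (Fin n → ℤ) → Fin n → ℤ
  laplacian z u = sum (λ x → + E H u x * (z u - z x))

  laplacian-cong : ∀ {z z′} → z ≗ z′ → laplacian z ≗ laplacian z′
  laplacian-cong z≗z′ u = sum-cong (λ x → cong₂ (λ p q → + E H u x * (p - q)) (z≗z′ u) (z≗z′ x))

  laplacian-+ : ∀ z₁ z₂ u → laplacian (λ x → z₁ x + z₂ x) u ≡ laplacian z₁ u + laplacian z₂ u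
  laplacian-+ z₁ z₂ u =
    trans (sum-cong (λ x → distrib (+ E H u x) (z₁ u) (z₁ x) (z₂ u) (z₂ x))) (∑-distrib-+ {n} _ _)
    where
    distrib : ∀ e p q r s → e * ((p + r) - (q + s)) ≡ e * (p - q) + e * (r - s)
    distrib = solve-∀

  laplacian-neg : ∀ z u → laplacian (λ x → - z x) u ≡ - laplacian z u
  laplacian-neg z u = trans (sum-cong (λ x → distrib (+ E H u x) (z u) (z x))) (sum-neg {n} _)
    where
    distrib : ∀ e p q → e * (- p - - q) ≡ - (e * (p - q))
    distrib = solve-∀

  laplacian-+const : ∀ z c → laplacian (λ x → z x + c) ≗ laplacian z
  laplacian-+const z c u = sum-cong (λ x → cancel (+ E H u x) (z u) (z x) c)
    where
    cancel : ∀ e p q c → e * ((p + c) - (q + c)) ≡ e * (p - q)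
    cancel = solve-∀

  laplacian-0 : ∀ u → laplacian (const 0ℤ) u ≡ 0ℤ
  laplacian-0 u = trans (sum-cong (λ x → ℤP.*-zeroʳ (+ E H u x))) (sum-replicate-zero n)

  sum-laplacian : ∀ z → sum (laplacian z) ≡ 0ℤ
  sum-laplacian z = begin
    sum (laplacian z)                ≡⟨ sum-cong split ⟩
    sum (λ u → out u - in′ u)        ≡⟨ sum-sub out in′ ⟩
    sum out - sum in′                ≡⟨ cong (_-_ (sum out)) in≡out ⟩
    sum out - sum out                ≡⟨ ℤP.+-inverseʳ (sum out) ⟩
    0ℤ                               ∎
    where
    open ≡-Reasoning
    out in′ : Fin n → ℤ
    out u = sum (λ x → + E H u x * z u)
    in′ u = sum (λ x → + E H u x * z x)
    split : ∀ u → laplacian z u ≡ out u - in′ u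
    split u = trans (sum-cong (λ x → distrib (+ E H u x) (z u) (z x))) (sum-sub {n} _ _)
      where
      distrib : ∀ e p q → e * (p - q) ≡ e * p - e * q
      distrib = solve-∀
    in≡out : sum in′ ≡ sum out
    in≡out = trans (∑-comm (λ u x → + E H u x * z x))
                   (sum-cong (λ x → sum-cong (λ u → cong (λ e → + e * z x) (symmetric H u x))))

  laplacian-δ-self : ∀ v → laplacian (δ v) v ≡ + val H v
  laplacian-δ-self v = trans (sum-cong term) (sym (+-sumFinℕ (E H v)))
    where
    term : ∀ x → + E H v x * (δ v v - δ v x) ≡ + E H v x
    term x with x ≟ v
    ... | yes refl rewrite loopless H v = refl
    ... | no  _    rewrite δ-self v     = ℤP.*-identityʳ (+ E H v x)

  laplacian-δ-other : ∀ {v u} → u ≢ v → laplacian (δ v) u ≡ - + E H v u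
  laplacian-δ-other {v} {u} u≢v = begin
    laplacian (δ v) u                 ≡⟨ sum-single v _ off-v ⟩
    + E H u v * (δ v u - δ v v)       ≡⟨ cong₂ (λ p q → + E H u v * (p - q)) (δ-other u≢v) (δ-self v) ⟩
    + E H u v * -[1+ 0 ]              ≡⟨ ℤP.*-comm (+ E H u v) -[1+ 0 ] ⟩
    -[1+ 0 ] * + E H u v              ≡⟨ ℤP.-1*i≡-i (+ E H u v) ⟩
    - + E H u v                       ≡⟨ cong (λ e → - + e) (symmetric H u v) ⟩
    - + E H v u                       ∎
    where
    open ≡-Reasoning
    off-v : ∀ x → x ≢ v → + E H u x * (δ v u - δ v x) ≡ 0ℤ
    off-v x x≢v = trans (cong₂ (λ p q → + E H u x * (p - q)) (δ-other u≢v) (δ-other x≢v))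
                        (ℤP.*-zeroʳ (+ E H u x))

  fire≗ : ∀ v D → fire H v D ≗ λ u → D u - laplacian (δ v) u
  fire≗ v D u = by-cases (laplacian (δ v) u) (λ { refl → laplacian-δ-self u }) laplacian-δ-other
    where
    by-cases : ∀ L → (u ≡ v → L ≡ + val H v) → (u ≢ v → L ≡ - + E H v u) → fire H v D u ≡ D u - L
    by-cases L self other with u ≟ v
    ... | yes u≡v = cong (_-_ (D u)) (sym (self u≡v))
    ... | no  u≢v = cong (_+_ (D u)) (trans (sym (ℤP.neg-involutive (+ E H v u)))
                                            (cong -_ (sym (other u≢v))))

  fire-then-script : ∀ v D z u →
    fire H v D u - laplacian z u ≡ D u - laplacian (λ x → δ v x + z x) u
  fire-then-script v D z u = begin
    fire H v D u - laplacian z u                 ≡⟨ cong (_- laplacian z u) (fire≗ v D u) ⟩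
    D u - laplacian (δ v) u - laplacian z u      ≡⟨ sub-sub (D u) (laplacian (δ v) u) (laplacian z u) ⟩
    D u - (laplacian (δ v) u + laplacian z u)    ≡⟨ cong (_-_ (D u)) (sym (laplacian-+ (δ v) z u)) ⟩
    D u - laplacian (λ x → δ v x + z x) u        ∎
    where
    open ≡-Reasoning
    sub-sub : ∀ p q r → p - q - r ≡ p - (q + r)
    sub-sub = solve-∀

  ∼⇒laplacian : ∀ {D D′} → _∼_ H D D′ → ∃ λ z → ∀ u → D′ u ≡ D u - laplacian z u
  ∼⇒laplacian {D} ε = const 0ℤ , λ u →
    sym (trans (cong (_-_ (D u)) (laplacian-0 u)) (ℤP.+-identityʳ (D u)))
  ∼⇒laplacian {D} ((v , refl) ◅ steps) with ∼⇒laplacian steps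
  ... | z , D′≡ = (λ x → δ v x + z x) , λ u → trans (D′≡ u) (fire-then-script v D z u)

  fire-script : ∀ {N} (y : Fin n → ℕ) → sumFinℕ y ≡ N → ∀ D →
    ∃ λ D′ → _∼_ H D D′ × ∀ u → D′ u ≡ D u - laplacian (+_ ∘ y) u
  fire-script {zero} y Σy≡0 D = D , ε , λ u → sym (begin
    D u - laplacian (+_ ∘ y) u   ≡⟨ cong (_-_ (D u)) (laplacian-cong (λ x → cong +_ (sumFinℕ≡0 y Σy≡0 x)) u) ⟩
    D u - laplacian (const 0ℤ) u ≡⟨ cong (_-_ (D u)) (laplacian-0 u) ⟩
    D u - 0ℤ                     ≡⟨ ℤP.+-identityʳ (D u) ⟩
    D u                          ∎)
    where open ≡-Reasoning
  fire-script {suc N} y Σy≡1+N D with sumFinℕ-peel y Σy≡1+N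
  ... | v , y′ , Σy′≡N , split with fire-script y′ Σy′≡N (fire H v D)
  ...   | D′ , D∼D′ , D′≡ = D′ , (v , refl) ◅ D∼D′ , λ u → begin
    D′ u                                      ≡⟨ D′≡ u ⟩
    fire H v D u - laplacian (+_ ∘ y′) u      ≡⟨ fire-then-script v D (+_ ∘ y′) u ⟩
    D u - laplacian (λ x → δ v x + + y′ x) u  ≡⟨ cong (_-_ (D u)) (laplacian-cong (λ x → sym (split x)) u) ⟩
    D u - laplacian (+_ ∘ y) u                ∎
    where open ≡-Reasoning

  -- Adding a constant to a script does not change its effect, so every script can be made nonnegative.
  laplacian⇒∼ : ∀ D z → ∃ λ D′ → _∼_ H D D′ × ∀ u → D′ u ≡ D u - laplacian z u
  laplacian⇒∼ D z =
    let D′ , D∼D′ , D′≡ = fire-script y refl D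
    in D′ , D∼D′ , λ u → trans (D′≡ u) (cong (_-_ (D u)) (begin
      laplacian (+_ ∘ y) u             ≡⟨ laplacian-cong y≗z+c u ⟩
      laplacian (λ x → z x + + c) u    ≡⟨ laplacian-+const z (+ c) u ⟩
      laplacian z u                    ∎))
    where
    open ≡-Reasoning
    c : ℕ
    c = sumFinℕ (∣_∣ ∘ z)
    y : Fin n → ℕ
    y x = ∣ z x + + c ∣
    y≗z+c : +_ ∘ y ≗ λ x → z x + + c
    y≗z+c x = ℤP.0≤i⇒+∣i∣≡i (0≤i+c (z x) (term≤sumFinℕ (∣_∣ ∘ z) x))

  Winnable : (Fin n → ℤ) → Set
  Winnable D = ∃ λ z → ∀ u → 0ℤ ≤ D u - laplacian z u

  equivEffective⇒winnable : ∀ {D} → EquivEffective H D → Winnable D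
  equivEffective⇒winnable (D′ , D∼D′ , D′≥0) with ∼⇒laplacian D∼D′
  ... | z , D′≡ = z , λ u → subst (0ℤ ≤_) (D′≡ u) (D′≥0 u)

  winnable⇒equivEffective : ∀ {D} → Winnable D → EquivEffective H D
  winnable⇒equivEffective {D} (z , D-Δz≥0) with laplacian⇒∼ D z
  ... | D′ , D∼D′ , D′≡ = D′ , D∼D′ , λ u → subst (0ℤ ≤_) (sym (D′≡ u)) (D-Δz≥0 u)

  winnable-mono : ∀ {D D′} → (∀ u → D u ≤ D′ u) → Winnable D → Winnable D′
  winnable-mono D≤D′ (z , D-Δz≥0) = z , λ u → ℤP.≤-trans (D-Δz≥0 u) (ℤP.+-monoˡ-≤ _ (D≤D′ u))

  winnable-cong : ∀ {D D′} → D ≗ D′ → Winnable D → Winnable D′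
  winnable-cong D≗D′ = winnable-mono (ℤP.≤-reflexive ∘ D≗D′)

  effective⇒winnable : ∀ {D} → (∀ u → 0ℤ ≤ D u) → Winnable D
  effective⇒winnable {D} D≥0 = const 0ℤ , λ u →
    subst (0ℤ ≤_) (sym (trans (cong (_-_ (D u)) (laplacian-0 u)) (ℤP.+-identityʳ (D u)))) (D≥0 u)

  winnable-+laplacian : ∀ {D} z → Winnable D → Winnable (λ u → D u + laplacian z u)
  winnable-+laplacian {D} z (z′ , D-Δz′≥0) = (λ x → z′ x + z x) , λ u →
    subst (0ℤ ≤_) (sym (trans (cong (_-_ (D u + laplacian z u)) (laplacian-+ z′ z u))
                              (cancel (D u) (laplacian z u) (laplacian z′ u))))
          (D-Δz′≥0 u)
    where
    cancel : ∀ d l l′ → d + l - (l′ + l) ≡ d - l′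
    cancel = solve-∀

  ChipRemovalsWinnable : (Fin n → ℤ) → Set
  ChipRemovalsWinnable X = ∀ u → Winnable (λ i → X i - δ u i)

chipRemovalsWinnable⇒winnable : ∀ {n} (H : MGraph n) {X} → ChipRemovalsWinnable H X → Winnable H X
chipRemovalsWinnable⇒winnable {zero}  H X-δ = (λ ()) , (λ ())
chipRemovalsWinnable⇒winnable {suc n} H {X} X-δ = winnable-mono H (δ-removal-≤ X zero) (X-δ zero)

module _ {n} (H : MGraph n) where
  open Int using (_+_; _-_; _*_; -_; _≤_)

  chipRemovalsWinnable-cong : ∀ {X Y} → X ≗ Y → ChipRemovalsWinnable H X → ChipRemovalsWinnable H Y
  chipRemovalsWinnable-cong X≗Y X-δ = λ u → winnable-cong H (λ i → cong (_- δ u i) (X≗Y i)) (X-δ u)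

  chipRemovalsWinnable-+laplacian : ∀ {X} z → ChipRemovalsWinnable H X →
    ChipRemovalsWinnable H (λ u → X u + laplacian H z u)
  chipRemovalsWinnable-+laplacian {X} z X-δ u =
    winnable-cong H (λ i → swap (X i) (δ u i) (laplacian H z i))
      (winnable-+laplacian H {λ i → X i - δ u i} z (X-δ u))
    where
    swap : ∀ x d l → x - d + l ≡ x + l - d
    swap = solve-∀

  chips-one≗δ : ∀ u → chips H 1 u ≗ δ u
  chips-one≗δ u i = trans (chips≗δ H 1 u i) (ℤP.*-identityʳ (δ u i))

  positiveRank⇒chipRemovalsWinnable : ∀ {X} → PositiveRank H X → ChipRemovalsWinnable H X
  positiveRank⇒chipRemovalsWinnable {X} (_ , X-F) u =
    winnable-cong H (λ i → cong (_-_ (X i)) (chips-one≗δ u i))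
      (equivEffective⇒winnable H (X-F (chips H 1 u) one≥0 deg-one))
    where
    one≥0 : Effective H (chips H 1 u)
    one≥0 i = subst (0ℤ ≤_) (sym (chips-one≗δ u i)) (δ-nonneg u i)
    deg-one : deg H (chips H 1 u) ≡ + 1
    deg-one = trans (sumFinℤ≡sum (chips H 1 u)) (trans (sum-cong (chips-one≗δ u)) (sum-δ u))

  chipRemovalsWinnable⇒positiveRank : ∀ {X} → ChipRemovalsWinnable H X → PositiveRank H X
  chipRemovalsWinnable⇒positiveRank {X} X-δ =
    winnable⇒equivEffective H (chipRemovalsWinnable⇒winnable H {X} X-δ) , λ F F≥0 deg-one →
    let (u , F≗δu) = unit-mass F F≥0 (trans (sym (sumFinℤ≡sum F)) deg-one)
    in winnable⇒equivEffective H
         (winnable-cong H {λ i → X i - δ u i} (λ i → cong (_-_ (X i)) (sym (F≗δu i))) (X-δ u))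

  positiveRank-cong : ∀ {X Y} → X ≗ Y → PositiveRank H X → PositiveRank H Y
  positiveRank-cong X≗Y = chipRemovalsWinnable⇒positiveRank
                        ∘ chipRemovalsWinnable-cong X≗Y
                        ∘ positiveRank⇒chipRemovalsWinnable

module LeafRemoval {m} (G : MGraph (suc m)) (v : Fin (suc m)) (w : Fin m)
                   (leaf : LeafWithNeighbour G v (punchIn v w)) where
  open Int using (_+_; _-_; _*_; -_; _≤_)

  G′ : MGraph m
  G′ = delete G v

  a : ℕ
  a = E G v (punchIn v w)

  0<a : 0 ℕ.< a
  0<a = proj₁ leaf

  restrict : (Fin (suc m) → ℤ) → Fin m → ℤ
  restrict D = D ∘ punchIn v

  extend : (Fin m → ℤ) → ℤ → Fin (suc m) → ℤ
  extend Y c u with v ≟ u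
  ... | yes _   = c
  ... | no  v≢u = Y (punchOut v≢u)

  extend-v : ∀ Y c → extend Y c v ≡ c
  extend-v Y c with v ≟ v
  ... | yes _   = refl
  ... | no  v≢v = ⊥-elim (v≢v refl)

  restrict-extend : ∀ Y c → restrict (extend Y c) ≗ Y
  restrict-extend Y c i with v ≟ punchIn v i
  ... | yes v≡i = ⊥-elim (punchInᵢ≢i v i (sym v≡i))
  ... | no  v≢i = cong Y (trans (punchOut-cong v refl) (punchOut-punchIn v))

  vertex-cases : (P : Fin (suc m) → Set) → P v → (∀ i → P (punchIn v i)) → ∀ u → P u
  vertex-cases P Pv Pi u with v ≟ u
  ... | yes refl = Pv
  ... | no  v≢u  = subst P (punchIn-punchOut v≢u) (Pi (punchOut v≢u))

  deg-split : ∀ D → deg G D ≡ D v + deg G′ (restrict D)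
  deg-split D = begin
    deg G D                       ≡⟨ sumFinℤ≡sum D ⟩
    sum D                         ≡⟨ sum-remove {i = v} D ⟩
    D v + sum (restrict D)        ≡⟨ cong (_+_ (D v)) (sym (sumFinℤ≡sum (restrict D))) ⟩
    D v + deg G′ (restrict D)     ∎
    where open ≡-Reasoning

  edge-from-leaf : ∀ u → u ≢ punchIn v w → E G v u ≡ 0
  edge-from-leaf u u≢w with E G v u in e
  ... | zero  = refl
  ... | suc _ = ⊥-elim (u≢w (proj₂ leaf u (subst (0 ℕ.<_) (sym e) (s≤s z≤n))))

  laplacian-at-leaf : ∀ z → laplacian G z v ≡ + a * (z v - z (punchIn v w))
  laplacian-at-leaf z =
    sum-single (punchIn v w) _ (λ u u≢w → cong (λ e → + e * (z v - z u)) (edge-from-leaf u u≢w))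

  laplacian-off-leaf : ∀ z i → laplacian G z (punchIn v i) ≡
    addChips w (+ a * (z (punchIn v w) - z v)) (laplacian G′ (restrict z)) i
  laplacian-off-leaf z i = begin
    laplacian G z (punchIn v i)                           ≡⟨ sum-remove {i = v} term ⟩
    term v + Δ′                                           ≡⟨ ℤP.+-comm (term v) Δ′ ⟩
    Δ′ + + E G (punchIn v i) v * (z (punchIn v i) - z v)  ≡⟨ cong (_+_ Δ′) edge-term ⟩
    Δ′ + δ w i * (+ a * (z (punchIn v w) - z v))          ∎
    where
    open ≡-Reasoning
    term : Fin (suc m) → ℤ
    term x = + E G (punchIn v i) x * (z (punchIn v i) - z x)
    Δ′ : ℤ
    Δ′ = laplacian G′ (restrict z) i
    edge-term : + E G (punchIn v i) v * (z (punchIn v i) - z v) ≡ δ w i * (+ a * (z (punchIn v w) - z v))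
    edge-term with i ≟ w
    ... | yes refl = trans (cong (λ e → + e * _) (symmetric G _ v)) (sym (ℤP.*-identityˡ _))
    ... | no  i≢w  = cong (λ e → + e * _)
                       (trans (symmetric G _ v) (edge-from-leaf _ (i≢w ∘ punchIn-injective v i w)))

  -- On G′ the script z acts as its restriction, plus a (z v - z w) chips moved from v to w.
  winnable-leaf⇒ : ∀ {D} → Winnable G D →
    ∃ λ t → + a * t ≤ D v × Winnable G′ (addChips w (+ a * t) (restrict D))
  winnable-leaf⇒ {D} (z , D-Δz≥0) = z v - z (punchIn v w) , at≤Dv , restrict z , λ i →
    subst (0ℤ ≤_) (rearrange i) (D-Δz≥0 (punchIn v i))
    where
    at≤Dv : + a * (z v - z (punchIn v w)) ≤ D v
    at≤Dv = ℤP.0≤i-j⇒j≤i (subst (λ l → 0ℤ ≤ D v - l) (laplacian-at-leaf z) (D-Δz≥0 v))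
    ring : ∀ d l e x p q → d - (l + e * (x * (p - q))) ≡ (d + e * (x * (q - p))) - l
    ring = solve-∀
    rearrange : ∀ i → D (punchIn v i) - laplacian G z (punchIn v i) ≡
      addChips w (+ a * (z v - z (punchIn v w))) (restrict D) i - laplacian G′ (restrict z) i
    rearrange i = trans (cong (_-_ (D (punchIn v i))) (laplacian-off-leaf z i))
      (ring (D (punchIn v i)) (laplacian G′ (restrict z) i) (δ w i) (+ a) (z (punchIn v w)) (z v))

  winnable-leaf⇐ : ∀ {D} t → + a * t ≤ D v → Winnable G′ (addChips w (+ a * t) (restrict D)) →
    Winnable G D
  winnable-leaf⇐ {D} t at≤Dv (z , p) = z⁺ , vertex-cases _ at-v off-v
    where
    z⁺ : Fin (suc m) → ℤ
    z⁺ = extend z (z w + t)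
    z⁺-w : z⁺ (punchIn v w) ≡ z w
    z⁺-w = restrict-extend z (z w + t) w
    ring-v : ∀ x p t → x * ((p + t) - p) ≡ x * t
    ring-v = solve-∀
    at-v : 0ℤ ≤ D v - laplacian G z⁺ v
    at-v = subst (λ l → 0ℤ ≤ D v - l)
      (sym (trans (laplacian-at-leaf z⁺)
        (trans (cong₂ (λ p q → + a * (p - q)) (extend-v z (z w + t)) z⁺-w) (ring-v (+ a) (z w) t))))
      (ℤP.i≤j⇒0≤j-i at≤Dv)
    ring-i : ∀ d l e x p t → d - (l + e * (x * (p - (p + t)))) ≡ (d + e * (x * t)) - l
    ring-i = solve-∀
    off-v : ∀ i → 0ℤ ≤ D (punchIn v i) - laplacian G z⁺ (punchIn v i)
    off-v i = subst (0ℤ ≤_) (sym (begin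
      D (punchIn v i) - laplacian G z⁺ (punchIn v i)
        ≡⟨ cong (_-_ (D (punchIn v i))) (laplacian-off-leaf z⁺ i) ⟩
      D (punchIn v i) - (laplacian G′ (restrict z⁺) i + δ w i * (+ a * (z⁺ (punchIn v w) - z⁺ v)))
        ≡⟨ cong₂ (λ l q → D (punchIn v i) - (l + δ w i * (+ a * q)))
                 (laplacian-cong G′ (restrict-extend z (z w + t)) i)
                 (cong₂ _-_ z⁺-w (extend-v z (z w + t))) ⟩
      D (punchIn v i) - (laplacian G′ z i + δ w i * (+ a * (z w - (z w + t))))
        ≡⟨ ring-i (D (punchIn v i)) (laplacian G′ z i) (δ w i) (+ a) (z w) t ⟩
      addChips w (+ a * t) (restrict D) i - laplacian G′ z i ∎)) (p i)
      where open ≡-Reasoning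

  winnable-leaf-≤ : ∀ {D} s → (∀ t → + a * t ≤ D v → t ≤ s) → Winnable G D →
    Winnable G′ (addChips w (+ a * s) (restrict D))
  winnable-leaf-≤ {D} s bound W =
    let t , at≤Dv , W′ = winnable-leaf⇒ {D} W
    in winnable-mono G′ (addChips-mono w (ℤP.*-monoˡ-≤-nonNeg (+ a) (bound t at≤Dv)) (restrict D)) W′

  δ-punchIn : ∀ j i → δ (punchIn v j) (punchIn v i) ≡ δ j i
  δ-punchIn j i with i ≟ j
  ... | yes refl = δ-self (punchIn v i)
  ... | no  i≢j  = δ-other (i≢j ∘ punchIn-injective v i j)

  δ-leaf-punchIn : ∀ i → δ v (punchIn v i) ≡ 0ℤ
  δ-leaf-punchIn i = δ-other (punchInᵢ≢i v i)

  δ-punchIn-leaf : ∀ j → δ (punchIn v j) v ≡ 0ℤ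
  δ-punchIn-leaf j = δ-other (punchInᵢ≢i v j ∘ sym)

  restrict-removal : ∀ X j → restrict (λ i → X i - δ (punchIn v j) i) ≗ λ i → restrict X i - δ j i
  restrict-removal X j i = cong (_-_ (X (punchIn v i))) (δ-punchIn j i)

  restrict-removal-leaf : ∀ X → restrict (λ i → X i - δ v i) ≗ restrict X
  restrict-removal-leaf X i = trans (cong (_-_ (X (punchIn v i))) (δ-leaf-punchIn i)) (ℤP.+-identityʳ _)

  swap-removal : ∀ c Y j i → addChips w c Y i - δ j i ≡ addChips w c (λ i → Y i - δ j i) i
  swap-removal c Y j i = ring (Y i) (δ w i * c) (δ j i)
    where
    ring : ∀ y e d → y + e - d ≡ y - d + e
    ring = solve-∀

  a*t≤d⇒t≤⌊d/a⌋ : ∀ t d → + a * t ≤ + d → t ≤ + ⌊ d / a ⌋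
  a*t≤d⇒t≤⌊d/a⌋ -[1+ _ ] d _   = Int.-≤+
  a*t≤d⇒t≤⌊d/a⌋ (+ k)    d ak≤d =
    Int.+≤+ (a*q≤d⇒q≤⌊d/a⌋ 0<a (ℤP.drop‿+≤+ (subst (_≤ + d) (sym (ℤP.pos-* a k)) ak≤d)))

  a*t≤-1⇒t≤-1 : ∀ t → + a * t ≤ -[1+ 0 ] → t ≤ -[1+ 0 ]
  a*t≤-1⇒t≤-1 -[1+ _ ] _ = Int.-≤- z≤n
  a*t≤-1⇒t≤-1 (+ k) ak≤-1 with subst (_≤ -[1+ 0 ]) (sym (ℤP.pos-* a k)) ak≤-1
  ... | ()

  chipRemovalsWinnable-leaf⇐ : ∀ {X} t → + 1 ≤ X v → + a * t ≤ X v → (∀ i → 0ℤ ≤ X (punchIn v i)) →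
    ChipRemovalsWinnable G′ (addChips w (+ a * t) (restrict X)) → ChipRemovalsWinnable G X
  chipRemovalsWinnable-leaf⇐ {X} t 1≤Xv at≤Xv X′≥0 X′+at-δ = vertex-cases _ remove-leaf remove-other
    where
    no-chips : ∀ y e x → y + e * (x * 0ℤ) ≡ y
    no-chips = solve-∀
    remove-leaf : Winnable G (λ i → X i - δ v i)
    remove-leaf = winnable-leaf⇐ {λ i → X i - δ v i} 0ℤ
      (subst₂ _≤_ (sym (ℤP.*-zeroʳ (+ a))) (cong (_-_ (X v)) (sym (δ-self v))) (ℤP.i≤j⇒0≤j-i 1≤Xv))
      (effective⇒winnable G′ λ i → subst (0ℤ ≤_)
        (sym (trans (no-chips _ (δ w i) (+ a)) (restrict-removal-leaf X i)))
        (X′≥0 i))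
    remove-other : ∀ j → Winnable G (λ i → X i - δ (punchIn v j) i)
    remove-other j = winnable-leaf⇐ {λ i → X i - δ (punchIn v j) i} t
      (subst (+ a * t ≤_) (sym (trans (cong (_-_ (X v)) (δ-punchIn-leaf j)) (ℤP.+-identityʳ (X v)))) at≤Xv)
      (winnable-cong G′ (λ i → trans (swap-removal (+ a * t) (restrict X) j i)
                                     (addChips-cong w (+ a * t) (sym ∘ restrict-removal X j) i))
                         (X′+at-δ j))

  chipRemovalsWinnable-leaf⇒ : ∀ {X} d → X v ≡ + d → ChipRemovalsWinnable G X →
    ChipRemovalsWinnable G′ (addChips w (+ a * + ⌊ d / a ⌋) (restrict X))
  chipRemovalsWinnable-leaf⇒ {X} d Xv≡d X-δ j = winnable-cong G′ reorder
    (winnable-leaf-≤ {λ i → X i - δ (punchIn v j) i} (+ ⌊ d / a ⌋) bound (X-δ (punchIn v j)))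
    where
    c : ℤ
    c = + a * + ⌊ d / a ⌋
    bound : ∀ t → + a * t ≤ X v - δ (punchIn v j) v → t ≤ + ⌊ d / a ⌋
    bound t at≤ = a*t≤d⇒t≤⌊d/a⌋ t d (subst (+ a * t ≤_)
      (trans (cong (_-_ (X v)) (δ-punchIn-leaf j)) (trans (ℤP.+-identityʳ (X v)) Xv≡d)) at≤)
    reorder : addChips w c (restrict (λ i → X i - δ (punchIn v j) i)) ≗
              λ i → addChips w c (restrict X) i - δ j i
    reorder i = trans (addChips-cong w c (restrict-removal X j) i) (sym (swap-removal c (restrict X) j i))

  chipRemovalsWinnable-empty-leaf⇒ : ∀ {X} → X v ≡ 0ℤ → ChipRemovalsWinnable G X →
    Winnable G′ (addChips w (- + a) (restrict X))
  chipRemovalsWinnable-empty-leaf⇒ {X} Xv≡0 X-δ = winnable-cong G′ reorder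
    (winnable-leaf-≤ {λ i → X i - δ v i} -[1+ 0 ] bound (X-δ v))
    where
    bound : ∀ t → + a * t ≤ X v - δ v v → t ≤ -[1+ 0 ]
    bound t at≤ = a*t≤-1⇒t≤-1 t (subst (+ a * t ≤_) (cong₂ _-_ Xv≡0 (δ-self v)) at≤)
    reorder : addChips w (+ a * -[1+ 0 ]) (restrict (λ i → X i - δ v i)) ≗ addChips w (- + a) (restrict X)
    reorder i = trans (addChips-cong w _ (restrict-removal-leaf X) i)
      (cong (λ c → restrict X i + δ w i * c) (trans (ℤP.*-comm (+ a) -[1+ 0 ]) (ℤP.-1*i≡-i (+ a))))

module _ {n} (H : MGraph n) where
  open import Data.Nat.Base using (_+_; _≤_; _<_; _∸_)

  Adj-irrefl : ∀ x → ¬ Adj H x x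
  Adj-irrefl x = ℕP.<-irrefl (sym (loopless H x))

  Adj-sym : ∀ {x y} → Adj H x y → Adj H y x
  Adj-sym {x} {y} = subst (0 <_) (symmetric H x y)

  leaf? : Dec (∃₂ λ x y → LeafWithNeighbour H x y)
  leaf? = any? λ x → any? λ y → (0 ℕP.<? E H x y) ×-dec all? (λ u → (0 ℕP.<? E H x u) →-dec (u ≟ y))

  -- In a graph without leaves a walk can always continue without backtracking; it must
  -- revisit a vertex, and its first revisit closes a cycle.
  module LeaflessWalk (leafless : ∀ x y → ¬ LeafWithNeighbour H x y) {x₀ x₁} (x₀~x₁ : Adj H x₀ x₁) where

    another-neighbour : ∀ {x p} → Adj H x p → ∃ λ y → Adj H x y × y ≢ p
    another-neighbour {x} {p} x~p with any? (λ y → (0 ℕP.<? E H x y) ×-dec ¬? (y ≟ p))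
    ... | yes found = found
    ... | no  none  = ⊥-elim (leafless x p (x~p , λ y x~y →
                        decidable-stable (y ≟ p) (λ y≢p → none (y , x~y , y≢p))))

    walk : ℕ → ∃₂ λ p x → Adj H p x
    walk zero    = x₀ , x₁ , x₀~x₁
    walk (suc k) = let _ , x , p~x = walk k
                       y , x~y , _ = another-neighbour (Adj-sym p~x)
                   in x , y , x~y

    W : ℕ → Fin n
    W k = proj₁ (walk k)

    W-adj : ∀ k → Adj H (W k) (W (suc k))
    W-adj k = proj₂ (proj₂ (walk k))

    W-nonbacktracking : ∀ k → W (suc (suc k)) ≢ W k
    W-nonbacktracking k = proj₂ (proj₂ (another-neighbour (Adj-sym (W-adj k))))

    Repeat : ℕ → Set
    Repeat j = ∃ λ i → i < j × W i ≡ W j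

    repeat? : Decidable Repeat
    repeat? j = any<? (λ i → W i ≟ W j) j

    some-repeat : ∃ Repeat
    some-repeat with pigeonhole (ℕP.n<1+n n) (W ∘ toℕ)
    ... | i , j , i<j , Wi≡Wj = toℕ j , toℕ i , i<j , Wi≡Wj

    closed-segment-cycle : ∀ i k → let L = suc (suc (suc k)) in W (i + L) ≡ W i →
      (∀ a b → a < L → b < L → W (i + a) ≡ W (i + b) → a ≡ b) → HasCycle H
    closed-segment-cycle i k closes distinct = k , xs , injective , adjacent , closing
      where
      xs : Vec (Fin n) (suc (suc (suc k)))
      xs = tabulate (λ l → W (i + toℕ l))
      xs-at : ∀ l → lookup xs l ≡ W (i + toℕ l)
      xs-at = lookup∘tabulate (λ l → W (i + toℕ l))
      injective : ∀ l l′ → lookup xs l ≡ lookup xs l′ → l ≡ l′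
      injective l l′ eq = toℕ-injective (distinct (toℕ l) (toℕ l′) (toℕ<n l) (toℕ<n l′)
        (trans (sym (xs-at l)) (trans eq (xs-at l′))))
      adjacent : ∀ l → Adj H (lookup xs (inject₁ l)) (lookup xs (suc l))
      adjacent l = subst₂ (Adj H)
        (sym (trans (xs-at (inject₁ l)) (cong (λ t → W (i + t)) (toℕ-inject₁ l))))
        (sym (trans (xs-at (suc l)) (cong W (ℕP.+-suc i (toℕ l)))))
        (W-adj (i + toℕ l))
      closing : Adj H (lookup xs (fromℕ (suc (suc k)))) (lookup xs zero)
      closing = subst₂ (Adj H)
        (sym (trans (xs-at (fromℕ (suc (suc k)))) (cong (λ t → W (i + t)) (toℕ-fromℕ (suc (suc k))))))
        (trans (cong W (sym (ℕP.+-suc i (suc (suc k)))))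
          (trans closes (trans (cong W (sym (ℕP.+-identityʳ i))) (sym (xs-at zero)))))
        (W-adj (i + suc (suc k)))

    first-repeat-cycle : ∀ {j} → Least repeat? j → HasCycle H
    first-repeat-cycle {j} ((i , i<j , Wi≡Wj) , j-least) = of-length (j ∸ i) refl
      where
      i+L≡j : ∀ {L} → j ∸ i ≡ L → i + L ≡ j
      i+L≡j refl = ℕP.m+[n∸m]≡n (ℕP.<⇒≤ i<j)

      closes : ∀ {L} → j ∸ i ≡ L → W (i + L) ≡ W i
      closes L≡ = trans (cong W (i+L≡j L≡)) (sym Wi≡Wj)

      in-range : ∀ {L c} → j ∸ i ≡ L → c < L → i + c < j
      in-range L≡ c<L = subst (i + _ <_) (i+L≡j L≡) (ℕP.+-monoʳ-< i c<L)

      distinct : ∀ {L} → j ∸ i ≡ L → ∀ a b → a < L → b < L → W (i + a) ≡ W (i + b) → a ≡ b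
      distinct L≡ a b a<L b<L eq with ℕP.<-cmp a b
      ... | tri≈ _ a≡b _ = a≡b
      ... | tri< a<b _ _ = ⊥-elim (ℕP.<⇒≱ (in-range L≡ b<L)
                                          (j-least (i + b) (i + a , ℕP.+-monoʳ-< i a<b , eq)))
      ... | tri> _ _ b<a = ⊥-elim (ℕP.<⇒≱ (in-range L≡ a<L)
                                          (j-least (i + a) (i + b , ℕP.+-monoʳ-< i b<a , sym eq)))

      of-length : ∀ L → j ∸ i ≡ L → HasCycle H
      of-length 0 L≡ = ⊥-elim (ℕP.<-irrefl (trans (sym (ℕP.+-identityʳ i)) (i+L≡j L≡)) i<j)
      of-length 1 L≡ = ⊥-elim (Adj-irrefl (W i)
        (subst (Adj H (W i)) (trans (cong W (ℕP.+-comm 1 i)) (closes L≡)) (W-adj i)))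
      of-length 2 L≡ = ⊥-elim (W-nonbacktracking i (trans (cong W (ℕP.+-comm 2 i)) (closes L≡)))
      of-length (suc (suc (suc k))) L≡ = closed-segment-cycle i k (closes L≡) (distinct L≡)

    cycle : HasCycle H
    cycle = first-repeat-cycle (proj₂ (least repeat? (proj₂ some-repeat)))

first-edge : ∀ {n} (H : MGraph (suc (suc n))) → Star (Adj H) zero (suc zero) → ∃ (Adj H zero)
first-edge H (zero~x ◅ _) = _ , zero~x

bananaTree-leaf : ∀ {m} (H : MGraph (suc (suc m))) → BananaTree H →
  ∃₂ λ v w → LeafWithNeighbour H v (punchIn v w)
bananaTree-leaf H (connected , acyclic) with leaf? H
... | yes (v , u , leaf) = v , punchOut v≢u , subst (LeafWithNeighbour H v) (sym (punchIn-punchOut v≢u)) leaf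
  where
  v≢u : v ≢ u
  v≢u refl = Adj-irrefl H v (proj₁ leaf)
... | no no-leaf = ⊥-elim (acyclic (LeaflessWalk.cycle H (λ x y leaf → no-leaf (x , y , leaf))
                                      (proj₂ (first-edge H (connected zero (suc zero))))))

module _ {m} (H : MGraph (suc m)) (v : Fin (suc m)) (w : Fin m)
         (leaf : LeafWithNeighbour H v (punchIn v w)) where

  collapse : Fin (suc m) → Fin m
  collapse x with v ≟ x
  ... | yes _   = w
  ... | no  v≢x = punchOut v≢x

  collapse-punchIn : ∀ i → collapse (punchIn v i) ≡ i
  collapse-punchIn i with v ≟ punchIn v i
  ... | yes v≡i = ⊥-elim (punchInᵢ≢i v i (sym v≡i))
  ... | no  _   = trans (punchOut-cong v refl) (punchOut-punchIn v)

  collapse-neighbour : ∀ {y} (v≢y : v ≢ y) → y ≡ punchIn v w → punchOut v≢y ≡ w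
  collapse-neighbour _ y≡w = trans (punchOut-cong v y≡w) (punchOut-punchIn v)

  collapse-edge : ∀ {x y} → Adj H x y → Star (Adj (delete H v)) (collapse x) (collapse y)
  collapse-edge {x} {y} x~y with v ≟ x | v ≟ y
  ... | yes refl | yes refl = ⊥-elim (Adj-irrefl H v x~y)
  ... | yes refl | no  v≢y  = subst (Star (Adj (delete H v)) w)
                                (sym (collapse-neighbour v≢y (proj₂ leaf y x~y))) ε
  ... | no  v≢x  | yes refl = subst (λ t → Star (Adj (delete H v)) t w)
                                (sym (collapse-neighbour v≢x (proj₂ leaf x (Adj-sym H x~y)))) ε
  ... | no  v≢x  | no  v≢y  = subst₂ (Adj H) (sym (punchIn-punchOut v≢x)) (sym (punchIn-punchOut v≢y)) x~y ◅ ε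

  collapse-walk : ∀ {x y} → Star (Adj H) x y → Star (Adj (delete H v)) (collapse x) (collapse y)
  collapse-walk ε           = ε
  collapse-walk (x~y ◅ y⇝z) = collapse-edge x~y ◅◅ collapse-walk y⇝z

  delete-bananaTree : BananaTree H → BananaTree (delete H v)
  delete-bananaTree (connected , acyclic) = connected′ , acyclic′
    where
    connected′ : Connected (delete H v)
    connected′ i j = subst₂ (Star (Adj (delete H v))) (collapse-punchIn i) (collapse-punchIn j)
                       (collapse-walk (connected (punchIn v i) (punchIn v j)))
    acyclic′ : ¬ HasCycle (delete H v)
    acyclic′ (k , xs , injective , adjacent , closing) =
      acyclic (k , ys , injective′ , adjacent′ , closing′)
      where
      ys : Vec (Fin (suc m)) (suc (suc (suc k)))
      ys = map (punchIn v) xs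
      at : ∀ l → lookup ys l ≡ punchIn v (lookup xs l)
      at l = lookup-map l (punchIn v) xs
      injective′ : ∀ l l′ → lookup ys l ≡ lookup ys l′ → l ≡ l′
      injective′ l l′ eq = injective l l′ (punchIn-injective v _ _ (trans (sym (at l)) (trans eq (at l′))))
      adjacent′ : ∀ l → Adj H (lookup ys (inject₁ l)) (lookup ys (suc l))
      adjacent′ l = subst₂ (Adj H) (sym (at (inject₁ l))) (sym (at (suc l))) (adjacent l)
      closing′ : Adj H (lookup ys (fromℕ _)) (lookup ys zero)
      closing′ = subst₂ (Adj H) (sym (at (fromℕ _))) (sym (at zero)) closing

laplacian-one-vertex : ∀ (H : MGraph 1) z → laplacian H z zero ≡ 0ℤ
laplacian-one-vertex H z = cong (λ e → + e Int.* (z zero Int.- z zero) Int.+ 0ℤ) (loopless H zero)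

winnable? : ∀ {m} (H : MGraph (suc m)) → BananaTree H → Decidable (Winnable H)
winnable? {zero} H _ D with 0ℤ ℤP.≤? D zero
... | yes D≥0 = yes (effective⇒winnable H {D} λ { zero → D≥0 })
... | no  D≱0 = no λ (z , D-Δz≥0) → D≱0 (subst (0ℤ Int.≤_)
  (trans (cong (Int._-_ (D zero)) (laplacian-one-vertex H z)) (ℤP.+-identityʳ (D zero))) (D-Δz≥0 zero))
winnable? {suc m} H tree D with bananaTree-leaf H tree
... | v , w , leaf = decide
  where
  open LeafRemoval H v w leaf
  open Int using (_*_; _≤_)
  instance
    a≢0 : ℕ.NonZero a
    a≢0 = ℕ.>-nonZero 0<a
  -- q is the largest t with a t ≤ D v, so the leaf is best served by firing it q times more than w.
  q : ℤ
  q = D v Int./ℕ a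
  aq≤Dv : + a * q ≤ D v
  aq≤Dv = subst (_≤ D v) (ℤP.*-comm q (+ a)) ([n/ℕd]*d≤n (D v) a)
  q-greatest : ∀ t → + a * t ≤ D v → t ≤ q
  q-greatest t at≤Dv with t ℤP.≤? q
  ... | yes t≤q = t≤q
  ... | no  t≰q = ⊥-elim (ℤP.<⇒≱ (n<s[n/ℕd]*d (D v) a) (subst (_≤ D v) (ℤP.*-comm (+ a) (Int.suc q))
                    (ℤP.≤-trans (ℤP.*-monoˡ-≤-nonNeg (+ a) (ℤP.i<j⇒suc[i]≤j (ℤP.≰⇒> t≰q))) at≤Dv)))
  decide : Dec (Winnable H D)
  decide with winnable? G′ (delete-bananaTree H v w leaf tree) (addChips w (+ a * q) (restrict D))
  ... | yes W′ = yes (winnable-leaf⇐ {D} q aq≤Dv W′)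
  ... | no  ¬W′ = no (¬W′ ∘ winnable-leaf-≤ {D} q q-greatest)

positiveRank? : ∀ {m} (H : MGraph (suc m)) → BananaTree H → Decidable (PositiveRank H)
positiveRank? H tree X with all? (λ u → winnable? H tree (λ i → X i Int.- δ u i))
... | yes X-δ  = yes (chipRemovalsWinnable⇒positiveRank H X-δ)
... | no  ¬X-δ = no (¬X-δ ∘ positiveRank⇒chipRemovalsWinnable H)

exists-of-sum? : ∀ {n} (Q : (Fin n → ℕ) → Set) → (∀ {y y′} → y ≗ y′ → Q y → Q y′) → Decidable Q →
  ∀ N → Dec (∃ λ y → sumFinℕ y ≡ N × Q y)
exists-of-sum? {zero} Q Q-cong Q? zero = map′ (λ Q∅ → empty , refl , Q∅)
                                              (λ (_ , _ , Qy) → Q-cong (λ ()) Qy) (Q? empty)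
  where
  empty : Fin 0 → ℕ
  empty ()
exists-of-sum? {zero} Q Q-cong Q? (suc N) = no λ ()
exists-of-sum? {suc n} Q Q-cong Q? N = map′ from to (any<? head? (suc N))
  where
  open import Data.Nat.Base using (_+_; _∸_; _≤_; _<_)
  Head : ℕ → Set
  Head c = ∃ λ y → sumFinℕ y ≡ N ∸ c × Q (c ∷ y)
  head? : Decidable Head
  head? c = exists-of-sum? (Q ∘ (c ∷_)) (λ y≗y′ → Q-cong (λ { zero → refl ; (suc i) → y≗y′ i }))
                           (Q? ∘ (c ∷_)) (N ∸ c)
  from : (∃ λ c → c < suc N × Head c) → ∃ λ y → sumFinℕ y ≡ N × Q y
  from (c , c<1+N , y , Σy≡N∸c , Qc∷y) =
    c ∷ y , trans (cong (_+_ c) Σy≡N∸c) (ℕP.m+[n∸m]≡n (ℕ.s≤s⁻¹ c<1+N)) , Qc∷y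
  to : (∃ λ y → sumFinℕ y ≡ N × Q y) → ∃ λ c → c < suc N × Head c
  to (y , Σy≡N , Qy) = y zero , s≤s (subst (y zero ≤_) Σy≡N (ℕP.m≤m+n (y zero) _)) , y ∘ suc ,
    trans (sym (ℕP.m+n∸m≡n (y zero) _)) (cong (_∸ y zero) Σy≡N) ,
    Q-cong (λ { zero → refl ; (suc i) → refl }) Qy

Achieves : ∀ {n} (H : MGraph n) → Fin n → ℕ → ℕ → Set
Achieves H w k d = ∃ λ D → Effective H D × deg H D ≡ + d × PositiveRank H (_+ᴰ_ H D (chips H k w))

module _ {n} (H : MGraph n) (PR? : Decidable (PositiveRank H)) (w : Fin n) (k : ℕ) where
  open Int using (_+_; _-_; _≤_)

  private
    Q : (Fin n → ℕ) → Set
    Q y = PositiveRank H (_+ᴰ_ H (+_ ∘ y) (chips H k w))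

    Q-cong : ∀ {y y′} → y ≗ y′ → Q y → Q y′
    Q-cong y≗y′ = positiveRank-cong H (λ i → cong (λ c → + c + chips H k w i) (y≗y′ i))

    S : ℕ → Set
    S N = ∃ λ y → sumFinℕ y ≡ N × Q y

    chips-nonneg : ∀ i → 0ℤ ≤ chips H k w i
    chips-nonneg i with i ≟ w
    ... | yes _ = Int.+≤+ z≤n
    ... | no  _ = Int.+≤+ z≤n

    1-δ-nonneg : ∀ (u i : Fin n) → 0ℤ ≤ + 1 - δ u i
    1-δ-nonneg u i with i ≟ u
    ... | yes _ = Int.+≤+ z≤n
    ... | no  _ = Int.+≤+ z≤n

    -- With a chip on every vertex, every single chip removal leaves an effective divisor.
    all-ones : S (sumFinℕ {n} (const 1))
    all-ones = const 1 , refl , chipRemovalsWinnable⇒positiveRank H λ u →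
      effective⇒winnable H {λ i → + 1 + chips H k w i - δ u i} λ i →
        subst (0ℤ ≤_) (ring (chips H k w i) (δ u i)) (ℤP.+-mono-≤ (1-δ-nonneg u i) (chips-nonneg i))
      where
      ring : ∀ c d → + 1 - d + c ≡ + 1 + c - d
      ring = solve-∀

    degree : ∀ y → deg H (+_ ∘ y) ≡ + sumFinℕ y
    degree y = trans (sumFinℤ≡sum (+_ ∘ y)) (sym (+-sumFinℕ y))

  f-exists : ∃ (IsF H w k)
  f-exists =
    let N , (y , Σy≡N , Qy) , N-least = least (exists-of-sum? Q Q-cong (λ y → PR? _)) all-ones
    in N , (+_ ∘ y , (λ _ → Int.+≤+ z≤n) , trans (degree y) (cong +_ Σy≡N) , Qy) , λ D D≥0 PR →
       let ∣D∣≗D : +_ ∘ (∣_∣ ∘ D) ≗ D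
           ∣D∣≗D i = ℤP.0≤i⇒+∣i∣≡i (D≥0 i)
       in subst (+ N ≤_) (trans (sym (degree (∣_∣ ∘ D))) (sumFinℤ-cong ∣D∣≗D))
            (Int.+≤+ (N-least _ (∣_∣ ∘ D , refl ,
              positiveRank-cong H (λ i → cong (_+ chips H k w i) (sym (∣D∣≗D i))) PR)))

module _ {n} (H : MGraph n) (w : Fin n) where
  open Int using (_+_; _-_; _*_; -_; _≤_)

  +ᴰchips≗addChips : ∀ D k → _+ᴰ_ H D (chips H k w) ≗ addChips w (+ k) D
  +ᴰchips≗addChips D k i = cong (_+_ (D i)) (chips≗δ H k w i)

  addChips-effective : ∀ {D} k → (∀ i → 0ℤ ≤ D i) → ∀ i → 0ℤ ≤ addChips w (+ k) D i
  addChips-effective k D≥0 i = ℤP.+-mono-≤ (D≥0 i) chips≥0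
    where
    chips≥0 : 0ℤ ≤ δ w i * + k
    chips≥0 with i ≟ w
    ... | yes _ = subst (0ℤ ≤_) (sym (ℤP.*-identityˡ (+ k))) (Int.+≤+ z≤n)
    ... | no  _ = Int.+≤+ z≤n

  achieves-⊓ : ∀ {k x y} → Achieves H w k x → Achieves H w k y → Achieves H w k (x ℕ.⊓ y)
  achieves-⊓ {k} {x} {y} Ax Ay = [ (λ x⊓y≡x → subst (Achieves H w k) (sym x⊓y≡x) Ax)
                                 , (λ x⊓y≡y → subst (Achieves H w k) (sym x⊓y≡y) Ay) ]′ (ℕP.⊓-sel x y)

  isF-witness : ∀ {j x} → IsF H w j x →
    ∃ λ Y → (∀ i → 0ℤ ≤ Y i) × deg H Y ≡ + x × ChipRemovalsWinnable H (addChips w (+ j) Y)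
  isF-witness {j} ((Y , Y≥0 , deg≡x , PR) , _) =
    Y , Y≥0 , deg≡x ,
    chipRemovalsWinnable-cong H (+ᴰchips≗addChips Y j) (positiveRank⇒chipRemovalsWinnable H PR)

  isF-minimal : ∀ {j x} → IsF H w j x → ∀ {Y} → (∀ i → 0ℤ ≤ Y i) →
    ChipRemovalsWinnable H (addChips w (+ j) Y) → + x ≤ deg H Y
  isF-minimal {j} (_ , minimal) {Y} Y≥0 Y+j-δ = minimal Y Y≥0
    (chipRemovalsWinnable⇒positiveRank H (chipRemovalsWinnable-cong H (sym ∘ +ᴰchips≗addChips Y j) Y+j-δ))

  -- Moving j′ - j of the chips at w into the divisor itself.
  minimal-shift : ∀ {j x} → IsF H w j x → ∀ {Y g j′} → (∀ i → 0ℤ ≤ Y i) → deg H Y ≡ + g →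
    ChipRemovalsWinnable H (addChips w (+ j′) Y) → j ℕ.≤ j′ → x ℕ.+ j ℕ.≤ g ℕ.+ j′
  minimal-shift {j} {x} isF {Y} {g} {j′} Y≥0 deg≡g Y+j′-δ j≤j′ = begin
    x ℕ.+ j                ≤⟨ ℕP.+-monoˡ-≤ j x≤g+[j′∸j] ⟩
    g ℕ.+ (j′ ℕ.∸ j) ℕ.+ j ≡⟨ ℕP.+-assoc g _ j ⟩
    g ℕ.+ (j′ ℕ.∸ j ℕ.+ j) ≡⟨ cong (g ℕ.+_) (ℕP.m∸n+n≡m j≤j′) ⟩
    g ℕ.+ j′               ∎
    where
    open ℕP.≤-Reasoning
    Y′ : Fin n → ℤ
    Y′ = addChips w (+ (j′ ℕ.∸ j)) Y
    Y′≥0 : ∀ i → 0ℤ ≤ Y′ i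
    Y′≥0 = addChips-effective (j′ ℕ.∸ j) Y≥0
    deg-Y′ : deg H Y′ ≡ + (g ℕ.+ (j′ ℕ.∸ j))
    deg-Y′ = trans (sumFinℤ≡sum Y′) (trans (sum-addChips w _ Y)
               (trans (cong (_+ + (j′ ℕ.∸ j)) (trans (sym (sumFinℤ≡sum Y)) deg≡g)) (sym (ℤP.pos-+ g _))))
    Y′+j≗Y+j′ : addChips w (+ j) Y′ ≗ addChips w (+ j′) Y
    Y′+j≗Y+j′ i = trans (ring (Y i) (δ w i) (+ (j′ ℕ.∸ j)) (+ j))
      (cong (λ c → Y i + δ w i * c) (trans (sym (ℤP.pos-+ (j′ ℕ.∸ j) j)) (cong +_ (ℕP.m∸n+n≡m j≤j′))))
      where
      ring : ∀ y e p q → y + e * p + e * q ≡ y + e * (p + q)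
      ring = solve-∀
    Y′+j-δ : ChipRemovalsWinnable H (addChips w (+ j) Y′)
    Y′+j-δ = chipRemovalsWinnable-cong H (sym ∘ Y′+j≗Y+j′) Y+j′-δ
    x≤g+[j′∸j] : x ℕ.≤ g ℕ.+ (j′ ℕ.∸ j)
    x≤g+[j′∸j] = ℤP.drop‿+≤+ (subst (+ x ≤_) deg-Y′ (isF-minimal isF Y′≥0 Y′+j-δ))

  -- If c chips can be taken from w, firing turns Y - c·w into an effective divisor F with F + c·w ∼ Y.
  minimal-after-removal : ∀ {c y} → IsF H w c y → ∀ {Y g} → deg H Y ≡ + g →
    ChipRemovalsWinnable H Y → Winnable H (addChips w (- + c) Y) → y ℕ.+ c ℕ.≤ g
  minimal-after-removal {c} {y} isF {Y} {g} deg≡g Y-δ (z , F≥0) =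
    ℤP.drop‿+≤+ (subst₂ _≤_ (sym (ℤP.pos-+ y c)) (ring (+ g) (+ c)) (ℤP.+-monoˡ-≤ (+ c) y≤g-c))
    where
    F : Fin n → ℤ
    F i = addChips w (- + c) Y i - laplacian H z i
    F+c≗Y-Δz : addChips w (+ c) F ≗ λ i → Y i + laplacian H (λ x → - z x) i
    F+c≗Y-Δz i = trans (ring′ (Y i) (δ w i) (+ c) (laplacian H z i))
                       (cong (_+_ (Y i)) (sym (laplacian-neg H z i)))
      where
      ring′ : ∀ y e c l → y + e * - c - l + e * c ≡ y + - l
      ring′ = solve-∀
    deg-F : deg H F ≡ + g - + c
    deg-F = trans (sumFinℤ≡sum F) (begin
      sum F                                          ≡⟨ sum-sub _ (laplacian H z) ⟩
      sum (addChips w (- + c) Y) - sum (laplacian H z) ≡⟨ cong₂ _-_ (sum-addChips w _ Y) (sum-laplacian H z) ⟩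
      sum Y + - + c - 0ℤ                              ≡⟨ ℤP.+-identityʳ _ ⟩
      sum Y - + c                                     ≡⟨ cong (_- + c) (trans (sym (sumFinℤ≡sum Y)) deg≡g) ⟩
      + g - + c                                       ∎)
      where open ≡-Reasoning
    y≤g-c : + y ≤ + g - + c
    y≤g-c = subst (+ y ≤_) deg-F (isF-minimal isF F≥0
      (chipRemovalsWinnable-cong H (sym ∘ F+c≗Y-Δz) (chipRemovalsWinnable-+laplacian H {Y} (λ x → - z x) Y-δ)))
    ring : ∀ g c → g - c + c ≡ g
    ring = solve-∀

module _ {m} (G : MGraph (suc m)) (v : Fin (suc m)) (w : Fin m)
         (leaf : LeafWithNeighbour G v (punchIn v w)) where
  open LeafRemoval G v w leaf
  open Int using (_+_; _-_; _*_; -_; _≤_)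

  private
    chips-at-leaf : ∀ k → chips G k v v ≡ + k
    chips-at-leaf k = trans (chips≗δ G k v v) (trans (cong (_* + k) (δ-self v)) (ℤP.*-identityˡ (+ k)))

    chips-off-leaf : ∀ k i → chips G k v (punchIn v i) ≡ 0ℤ
    chips-off-leaf k i = trans (chips≗δ G k v (punchIn v i)) (cong (_* + k) (δ-leaf-punchIn i))

    restrict-+chips : ∀ D k → restrict (_+ᴰ_ G D (chips G k v)) ≗ restrict D
    restrict-+chips D k i = trans (cong (_+_ (D (punchIn v i))) (chips-off-leaf k i)) (ℤP.+-identityʳ _)

  achieves-extend : ∀ c k q {j x} → j ≡ a ℕ.* q → IsF G′ w j x → 1 ℕ.≤ c ℕ.+ k → j ℕ.≤ c ℕ.+ k →
    Achieves G v k (c ℕ.+ x)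
  achieves-extend c k q {j} {x} j≡aq isF 1≤c+k j≤c+k = extended (isF-witness G′ w isF)
    where
    extended : (∃ λ Y → (∀ i → 0ℤ ≤ Y i) × deg G′ Y ≡ + x × ChipRemovalsWinnable G′ (addChips w (+ j) Y)) →
      Achieves G v k (c ℕ.+ x)
    extended (Y , Y≥0 , deg≡x , Y+j-δ) = D , D≥0 , deg-D , chipRemovalsWinnable⇒positiveRank G
      (chipRemovalsWinnable-leaf⇐ {_+ᴰ_ G D (chips G k v)} (+ q) (subst (+ 1 ≤_) (sym X-v) (Int.+≤+ 1≤c+k))
        (subst₂ _≤_ (trans (cong +_ j≡aq) (ℤP.pos-* a q)) (sym X-v) (Int.+≤+ j≤c+k))
        (λ i → subst (0ℤ ≤_) (sym (restrict-X i)) (Y≥0 i))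
        (chipRemovalsWinnable-cong G′ (λ i → cong₂ (λ y t → y + δ w i * t) (sym (restrict-X i))
                                                   (trans (cong +_ j≡aq) (ℤP.pos-* a q))) Y+j-δ))
      where
      D : Fin (suc m) → ℤ
      D = extend Y (+ c)
      D≥0 : Effective G D
      D≥0 = vertex-cases _ (subst (0ℤ ≤_) (sym (extend-v Y (+ c))) (Int.+≤+ z≤n))
                           (λ i → subst (0ℤ ≤_) (sym (restrict-extend Y (+ c) i)) (Y≥0 i))
      deg-D : deg G D ≡ + (c ℕ.+ x)
      deg-D = trans (deg-split D) (trans (cong₂ _+_ (extend-v Y (+ c))
                (trans (sumFinℤ-cong (restrict-extend Y (+ c))) deg≡x)) (sym (ℤP.pos-+ c x)))
      X-v : _+ᴰ_ G D (chips G k v) v ≡ + (c ℕ.+ k)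
      X-v = trans (cong₂ _+_ (extend-v Y (+ c)) (chips-at-leaf k)) (sym (ℤP.pos-+ c k))
      restrict-X : restrict (_+ᴰ_ G D (chips G k v)) ≗ Y
      restrict-X i = trans (restrict-+chips D k i) (restrict-extend Y (+ c) i)

  f-lower-bound : ∀ k b →
    (∀ d g {Y} → (∀ i → 0ℤ ≤ Y i) → deg G′ Y ≡ + g →
       ChipRemovalsWinnable G′ (addChips w (+ (a ℕ.* ⌊ (d ℕ.+ k) / a ⌋)) Y) →
       (d ℕ.+ k ≡ 0 → Winnable G′ (addChips w (- + a) Y)) → b ℕ.≤ d ℕ.+ g) →
    ∀ D → Effective G D → PositiveRank G (_+ᴰ_ G D (chips G k v)) → + b ≤ deg G D
  f-lower-bound k b bound D D≥0 PR =
    subst (+ b ≤_) (sym deg-D) (Int.+≤+ (bound d g Y≥0 (sym (ℤP.0≤i⇒+∣i∣≡i degY≥0))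
      (chipRemovalsWinnable-cong G′ (λ i → cong₂ (λ y t → y + δ w i * t) (restrict-+chips D k i)
                                                  (sym (ℤP.pos-* a _)))
        (chipRemovalsWinnable-leaf⇒ {_+ᴰ_ G D (chips G k v)} (d ℕ.+ k) X-v X-δ))
      (λ d+k≡0 → winnable-cong G′ (addChips-cong w (- + a) (restrict-+chips D k))
        (chipRemovalsWinnable-empty-leaf⇒ {_+ᴰ_ G D (chips G k v)} (trans X-v (cong +_ d+k≡0)) X-δ))))
    where
    d g : ℕ
    d = ∣ D v ∣
    g = ∣ deg G′ (restrict D) ∣
    Y≥0 : ∀ i → 0ℤ ≤ restrict D i
    Y≥0 i = D≥0 (punchIn v i)
    degY≥0 : 0ℤ ≤ deg G′ (restrict D)
    degY≥0 = subst (0ℤ ≤_) (sym (sumFinℤ≡sum (restrict D))) (sum-nonneg _ Y≥0)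
    deg-D : deg G D ≡ + (d ℕ.+ g)
    deg-D = trans (deg-split D) (trans (sym (cong₂ _+_ (ℤP.0≤i⇒+∣i∣≡i (D≥0 v)) (ℤP.0≤i⇒+∣i∣≡i degY≥0)))
                                       (sym (ℤP.pos-+ d g)))
    X-v : _+ᴰ_ G D (chips G k v) v ≡ + (d ℕ.+ k)
    X-v = trans (cong₂ _+_ (sym (ℤP.0≤i⇒+∣i∣≡i (D≥0 v))) (chips-at-leaf k)) (sym (ℤP.pos-+ d k))
    X-δ : ChipRemovalsWinnable G (_+ᴰ_ G D (chips G k v))
    X-δ = positiveRank⇒chipRemovalsWinnable G PR

module _ {m} (G : MGraph (suc m)) (v : Fin (suc m)) (w : Fin m)
         (leaf : LeafWithNeighbour G v (punchIn v w)) where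
  open LeafRemoval G v w leaf using (G′; a; 0<a)
  open import Data.Nat.Base using (_+_; _*_; _∸_; _≤_; _<_; _⊓_)
  open import Data.Nat.Tactic.RingSolver using () renaming (solve-∀ to solveℕ-∀)

  private
    slack-bound : ∀ {k M N d g y} → k ≤ M → y + M ≤ g + N → N ≤ d + k → (M ∸ k) + y ≤ d + g
    slack-bound {k} {M} {N} {d} {g} {y} k≤M y+M≤g+N N≤d+k = ℕP.+-cancelʳ-≤ k _ _ (begin
      M ∸ k + y + k       ≡⟨ reorder (M ∸ k) y k ⟩
      y + (M ∸ k + k)     ≡⟨ cong (_+_ y) (ℕP.m∸n+n≡m k≤M) ⟩
      y + M               ≤⟨ y+M≤g+N ⟩
      g + N               ≤⟨ ℕP.+-monoʳ-≤ g N≤d+k ⟩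
      g + (d + k)         ≡⟨ reorder′ g d k ⟩
      d + g + k           ∎)
      where
      open ℕP.≤-Reasoning
      reorder : ∀ p y k → p + y + k ≡ y + (p + k)
      reorder = solveℕ-∀
      reorder′ : ∀ g d k → g + (d + k) ≡ d + g + k
      reorder′ = solveℕ-∀

  f-at-leaf-zero : ∀ {x y} → IsF G′ w 0 x → IsF G′ w a y → IsF G v 0 ((1 + x) ⊓ (a + y))
  f-at-leaf-zero {x} {y} fx fy =
    achieves-⊓ G v (achieves-extend G v w leaf 1 0 0 (sym (ℕP.*-zeroʳ a)) fx (s≤s z≤n) z≤n)
                   (achieves-extend G v w leaf a 0 1 (sym (ℕP.*-identityʳ a)) fy
                      (ℕP.≤-trans 0<a (ℕP.m≤m+n a 0)) (ℕP.≤-reflexive (sym (ℕP.+-identityʳ a)))) ,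
    f-lower-bound G v w leaf 0 _ bound
    where
    no-chips : ∀ {Y} → addChips w (+ (a * ⌊ 0 / a ⌋)) Y ≗ Y
    no-chips {Y} i = trans (cong (λ t → Y i Int.+ δ w i Int.* + t) (a*⌊0/a⌋≡0 a))
                           (trans (cong (Int._+_ (Y i)) (ℤP.*-zeroʳ (δ w i))) (ℤP.+-identityʳ (Y i)))
    bound : ∀ d g {Y} → (∀ i → 0ℤ Int.≤ Y i) → deg G′ Y ≡ + g →
      ChipRemovalsWinnable G′ (addChips w (+ (a * ⌊ (d + 0) / a ⌋)) Y) →
      (d + 0 ≡ 0 → Winnable G′ (addChips w (Int.- + a) Y)) → (1 + x) ⊓ (a + y) ≤ d + g
    bound zero g {Y} Y≥0 deg≡g Y+j-δ empty = ℕP.≤-trans (ℕP.m⊓n≤n (1 + x) (a + y))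
      (subst (_≤ g) (ℕP.+-comm y a) (minimal-after-removal G′ w fy deg≡g
        (chipRemovalsWinnable-cong G′ (no-chips {Y}) Y+j-δ) (empty refl)))
    bound (suc d) g {Y} Y≥0 deg≡g Y+j-δ _ = by-quotient ⌊ (suc d + 0) / a ⌋ (a*⌊k/a⌋≤k a (suc d + 0)) Y+j-δ
      where
      by-quotient : ∀ q → a * q ≤ suc d + 0 → ChipRemovalsWinnable G′ (addChips w (+ (a * q)) Y) →
        (1 + x) ⊓ (a + y) ≤ suc d + g
      by-quotient zero _ Y-δ = ℕP.≤-trans (ℕP.m⊓n≤m (1 + x) (a + y)) (s≤s (ℕP.≤-trans
        (subst₂ _≤_ (ℕP.+-identityʳ x) (trans (cong (_+_ g) (ℕP.*-zeroʳ a)) (ℕP.+-identityʳ g))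
                (minimal-shift G′ w fx Y≥0 deg≡g Y-δ z≤n))
        (ℕP.m≤n+m g d)))
      by-quotient (suc q) aq≤1+d Y-δ = ℕP.≤-trans (ℕP.m⊓n≤n (1 + x) (a + y))
        (slack-bound {M = a} {y = y} z≤n (minimal-shift G′ w fy Y≥0 deg≡g Y-δ (ℕP.m≤m*n a (suc q))) aq≤1+d)

  f-at-leaf-positive : ∀ k → 0 < k → ∀ {x y} → IsF G′ w (a * ⌊ k / a ⌋) x → IsF G′ w (a * ⌈ k / a ⌉) y →
    IsF G v k (x ⊓ ((a * ⌈ k / a ⌉ ∸ k) + y))
  f-at-leaf-positive k 0<k {x} {y} fx fy =
    achieves-⊓ G v (achieves-extend G v w leaf 0 k ⌊ k / a ⌋ refl fx 0<k (a*⌊k/a⌋≤k a k))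
                   (achieves-extend G v w leaf (a * ⌈ k / a ⌉ ∸ k) k ⌈ k / a ⌉ refl fy
                      (ℕP.≤-trans 0<k (ℕP.m≤n+m k _)) (ℕP.≤-reflexive (sym (ℕP.m∸n+n≡m k≤aC)))) ,
    f-lower-bound G v w leaf k _ bound
    where
    k≤aC : k ≤ a * ⌈ k / a ⌉
    k≤aC = k≤a*⌈k/a⌉ k 0<a
    bound : ∀ d g {Y} → (∀ i → 0ℤ Int.≤ Y i) → deg G′ Y ≡ + g →
      ChipRemovalsWinnable G′ (addChips w (+ (a * ⌊ (d + k) / a ⌋)) Y) →
      (d + k ≡ 0 → Winnable G′ (addChips w (Int.- + a) Y)) → x ⊓ ((a * ⌈ k / a ⌉ ∸ k) + y) ≤ d + g
    bound d g Y≥0 deg≡g Y-δ _ with ℕP.m≤n⇒m<n∨m≡n (⌊/⌋-monoˡ-≤ a (ℕP.m≤n+m k d))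
    ... | inj₂ ⌊k/a⌋≡q = ℕP.≤-trans (ℕP.m⊓n≤m x _) (ℕP.≤-trans
      (ℕP.+-cancelʳ-≤ (a * ⌊ k / a ⌋) x g
        (subst (λ t → x + a * ⌊ k / a ⌋ ≤ g + a * t) (sym ⌊k/a⌋≡q)
          (minimal-shift G′ w fx Y≥0 deg≡g Y-δ (ℕP.≤-reflexive (cong (_*_ a) ⌊k/a⌋≡q)))))
      (ℕP.m≤n+m g d))
    ... | inj₁ ⌊k/a⌋<q = ℕP.≤-trans (ℕP.m⊓n≤n x _)
      (slack-bound k≤aC
        (minimal-shift G′ w fy Y≥0 deg≡g Y-δ
          (ℕP.*-monoʳ-≤ a (ℕP.≤-trans (⌈k/a⌉≤1+⌊k/a⌋ a k) ⌊k/a⌋<q)))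
        (a*⌊k/a⌋≤k a (d + k)))

open import Data.Nat.Base using (_+_; _*_; _∸_; _⊓_; _<_)

proposition3p2 : ∀ {m} (G : MGraph (suc m)) → BananaTree G →
    (v : Fin (suc m)) (w : Fin m) → LeafWithNeighbour G v (punchIn v w) →
    let a = E G v (punchIn v w) in
    (∃₂ λ x y → IsF (delete G v) w 0 x × IsF (delete G v) w a y ×
        IsF G v 0 ((1 + x) ⊓ (a + y)))
    × (∀ k → 0 < k → ∃₂ λ x y →
        IsF (delete G v) w (a * ⌊ k / a ⌋) x ×
        IsF (delete G v) w (a * ⌈ k / a ⌉) y ×
        IsF G v k (x ⊓ ((a * ⌈ k / a ⌉ ∸ k) + y)))
proposition3p2 {zero}  G tree v () leaf
proposition3p2 {suc m} G tree v w leaf =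
  (proj₁ (f 0) , proj₁ (f a) , proj₂ (f 0) , proj₂ (f a) ,
   f-at-leaf-zero G v w leaf (proj₂ (f 0)) (proj₂ (f a))) ,
  λ k 0<k → proj₁ (f (a * ⌊ k / a ⌋)) , proj₁ (f (a * ⌈ k / a ⌉)) ,
            proj₂ (f (a * ⌊ k / a ⌋)) , proj₂ (f (a * ⌈ k / a ⌉)) ,
            f-at-leaf-positive G v w leaf k 0<k (proj₂ (f (a * ⌊ k / a ⌋))) (proj₂ (f (a * ⌈ k / a ⌉)))
  where
  open LeafRemoval G v w leaf using (G′; a)
  f : ∀ j → ∃ (IsF G′ w j)
  f = f-exists G′ (positiveRank? G′ (delete-bananaTree G v w leaf tree)) w
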